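{- Consider a flight $(i,j,k)$ and two speeds $v,s\in V$ with $s>v$. If $$e^{s}_{ijk} + \left(\tau^v_{ijk} - \tau^s_{ijk}\right) P^{\text{H}}(0) \leq e^v_{ijk},$$ then the operation $(i,j,k)^v$ is dominated by the operation $(i,j,k)^{s}$.
   Context: Setting (vehicle routing problem with drones and drone speed selection). The nodes are a start depot $0$, customers $C=\{1,\dots,c\}$, and an end depot $c+1$ (same physical location as $0$); $\bar C\subseteq C$ is the set of customers that may be served by a drone. For nodes $a,b$, $\tau^{\text{T}}_{ab}\ge 0$ is the truck travel time from $a$ to $b$, and $\tau^{\text{S,T}}_l\ge 0$ is the truck service time at customer $l$. The drone distance between $a$ and $b$ is $\delta^{\text{D}}_{ab}\ge0$, the drone service time at customer $j$ is $\tau^{\text{S,D}}_j\ge 0$, and a drone can fly at any speed from a finite set $V\subset(0,\infty)$. A flight is a triple $(i,j,k)$ of pairwise distinct nodes (launch node $i\neq c+1$, customer $j\in\bar C$, retrieval node $k\neq 0$). An operation $(i,j,k)^v$ is the execution of the flight at constant speed $v\in V$; its duration is $\tau^v_{ijk}=\delta^{\text{D}}_{ij}/v+\tau^{\text{S,D}}_j+\delta^{\text{D}}_{jk}/v$, and its flight energy consumption is a given number $e^v_{ijk}\ge 0$. $P^{\text{H}}(0)>0$ denotes the power consumed by the drone when hovering without a package, and $\epsilon E>0$ is the maximum usable battery energy. Scenario semantics: measure time from the launch at $i$, at which moment the truck also leaves $i$. Let $T$ be the time at which the truck arrives at $k$. The drone reaches $k$ at time $\tau^v_{ijk}$ and hovers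 until the truck arrives, so the reunion occurs at time $\max(\tau^v_{ijk},T)$ and the energy consumed until reunion is $e^v_{ijk}+\max(T-\tau^v_{ijk},0)\,P^{\text{H}}(0)$. The operation is feasible in the scenario iff this energy is at most $\epsilon E$. Admissible scenarios: always $T\ge\tau^{\text{T}}_{ik}$; if the truck travels directly from $i$ to $k$ then $T=\tau^{\text{T}}_{ik}$; if the truck visits some customer $l\notin\{i,j,k\}$ between $i$ and $k$, then $T\ge \tau^{\text{T}}_{il}+\tau^{\text{S,T}}_l+\tau^{\text{T}}_{lk}$. Dominance: an operation $A$ of flight $(i,j,k)$ is dominated by an operation $B$ of the same flight if, in every admissible scenario in which $A$ is feasible, $B$ is also feasible, the reunion time with $B$ is no later than with $A$, and the energy consumed until reunion with $B$ is no larger than with $A$.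
   Formalization: All data are rational: the truck and drone times, the drone distances, the speeds in $V$, the energies $e^v_{ijk}$, $P^{\text{H}}(0)$, $\epsilon E$ and the truck arrival time $T$. -}

module Defs where

open import Data.Nat using (ℕ; suc)
open import Data.Fin using (Fin; zero; fromℕ)
open import Data.Bool using (Bool; true)
open import Data.Rational using (ℚ; 0ℚ; _+_; _-_; _*_; _⊔_; _≤_; _<_; 1/_; positive)
open import Data.Rational.Properties using (pos⇒nonZero)
open import Data.List using (List; [])
open import Data.List.Relation.Unary.All using (All)
import Data.List.Relation.Unary.All as All
open import Data.List.Membership.Propositional using (_∈_)
open import Data.Product using (_×_)
open import Relation.Binary.PropositionalEquality using (_≡_; _≢_)

-- Nodes of an instance with c customers: Fin (c + 2),
-- start depot 0 = zero, customers 1..c, end depot c+1 = fromℕ (suc c).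
Node : ℕ → Set
Node c = Fin (suc (suc c))

startDepot : ∀ {c} → Node c
startDepot = zero

endDepot : ∀ {c} → Node c
endDepot {c} = fromℕ (suc c)

IsCustomer : ∀ {c} → Node c → Set
IsCustomer l = (l ≢ startDepot) × (l ≢ endDepot)

-- Problem data (all reals are modelled by rationals)
record Instance (c : ℕ) : Set where
  field
    droneEligible : Node c → Bool          -- characteristic function of C̄ (on customers)
    τT   : Node c → Node c → ℚ
    τST  : Node c → ℚ
    δD   : Node c → Node c → ℚ
    τSD  : Node c → ℚ
    V    : List ℚ
    e    : Node c → Node c → Node c → ℚ → ℚ
    PH0  : ℚ
    εE   : ℚ
    τT≥0  : ∀ a b → 0ℚ ≤ τT a b
    τST≥0 : ∀ l → 0ℚ ≤ τST l
    δD≥0  : ∀ a b → 0ℚ ≤ δD a b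
    τSD≥0 : ∀ j → 0ℚ ≤ τSD j
    V>0   : All (λ v → 0ℚ < v) V
    e≥0   : ∀ i j k v → 0ℚ ≤ e i j k v
    PH0>0 : 0ℚ < PH0
    εE>0  : 0ℚ < εE

record Flight {c : ℕ} (I : Instance c) : Set where
  field
    i j k : Node c
    i≢j : i ≢ j
    i≢k : i ≢ k
    j≢k : j ≢ k
    i≢end : i ≢ endDepot
    j-customer : IsCustomer j
    j∈C̄ : Instance.droneEligible I j ≡ true
    k≢start : k ≢ startDepot

module _ {c : ℕ} (I : Instance c) (F : Flight I) where
  open Instance I
  open Flight F

  duration : (v : ℚ) → v ∈ V → ℚ
  duration v v∈V =
    let instance vpos = positive (All.lookup V>0 v∈V)
        instance vnz  = pos⇒nonZero v
    in δD i j * (1/ v) + τSD j + δD j k * (1/ v)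

  -- reunion time at k when the truck arrives at time T
  reunion : (v : ℚ) → v ∈ V → ℚ → ℚ
  reunion v v∈V T = duration v v∈V ⊔ T

  energy : (v : ℚ) → v ∈ V → ℚ → ℚ
  energy v v∈V T = e i j k v + ((T - duration v v∈V) ⊔ 0ℚ) * PH0

  Feasible : (v : ℚ) → v ∈ V → ℚ → Set
  Feasible v v∈V T = energy v v∈V T ≤ εE

  -- An admissible scenario: the list L of customers the truck visits strictly
  -- between i and k (none of them in {i,j,k}), and truck arrival time T at k.
  record Scenario : Set where
    field
      L : List (Node c)
      T : ℚ
      L-customers : All IsCustomer L
      L-fresh : All (λ l → (l ≢ i) × (l ≢ j) × (l ≢ k)) L
      T≥direct : τT i k ≤ T
      direct : L ≡ [] → T ≡ τT i k
      T≥via : All (λ l → τT i l + τST l + τT l k ≤ T) L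

  Dominated : (v : ℚ) → v ∈ V → (s : ℚ) → s ∈ V → Set
  Dominated v v∈V s s∈V =
    (σ : Scenario) → let T = Scenario.T σ in
      Feasible v v∈V T →
        Feasible s s∈V T × reunion s s∈V T ≤ reunion v v∈V T × energy s s∈V T ≤ energy v v∈V T

{-# OPTIONS --safe #-}
-- Since 1/s ≤ 1/v, the faster drone finishes its flight earlier, so it meets the
-- truck no later.  It may have to hover longer while waiting, but by at most
-- τ^v - τ^s, and the hypothesis says the flight energy it saves pays for exactly
-- that much hovering.  So its energy until reunion never exceeds that of the
-- slower drone, and feasibility carries over.
module Submission where

open import Defs
open import Data.Nat using (ℕ)
open import Data.Rational using (ℚ; _+_; _-_; _*_; _≤_; _<_)
open import Data.List.Membership.Propositional using (_∈_)
open import Data.Rational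
  using (0ℚ; -_; _⊔_; 1/_; Positive; positive; nonNegative; toℚᵘ)
open import Data.Rational.Properties
open import Data.Rational.Solver using (module +-*-Solver)
import Data.Rational.Unnormalised.Properties as ℚᵘ
open import Data.Product using (_,_)
import Data.List.Relation.Unary.All as All
open import Relation.Binary.PropositionalEquality using (_≡_; refl; sym; subst)

open +-*-Solver using (solve; _:=_; _:+_; _:*_; _:-_)

1/-antimono-≤-pos : ∀ {p q} .{{_ : Positive p}} .{{_ : Positive q}} →
                    p ≤ q → (1/ q) {{pos⇒nonZero q}} ≤ (1/ p) {{pos⇒nonZero p}}
1/-antimono-≤-pos {p} {q} p≤q = toℚᵘ-cancel-≤
  (ℚᵘ.≤-respˡ-≃ (ℚᵘ.≃-sym (toℚᵘ-homo-1/ q)) (ℚᵘ.≤-respʳ-≃ (ℚᵘ.≃-sym (toℚᵘ-homo-1/ p))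
    (ℚᵘ.1/-antimono-≤-pos (toℚᵘ-mono-≤ p≤q))))
  where
  instance
    _ = pos⇒nonZero p
    _ = pos⇒nonZero q

p≤q⇒0≤q-p : ∀ {p q} → p ≤ q → 0ℚ ≤ q - p
p≤q⇒0≤q-p {p} {q} p≤q = subst (_≤ q - p) (+-inverseʳ p) (+-monoˡ-≤ (- p) p≤q)

[p-r]⊔0≤[q-r]+[p-q]⊔0 : ∀ p q r → r ≤ q → (p - r) ⊔ 0ℚ ≤ (q - r) + ((p - q) ⊔ 0ℚ)
[p-r]⊔0≤[q-r]+[p-q]⊔0 p q r r≤q = ⊔-lub p-r≤rhs 0≤rhs
  where
  p-r≡[q-r]+[p-q] : p - r ≡ (q - r) + (p - q)
  p-r≡[q-r]+[p-q] = solve 3 (λ p q r → p :- r := (q :- r) :+ (p :- q)) refl p q r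
  p-r≤rhs : p - r ≤ (q - r) + ((p - q) ⊔ 0ℚ)
  p-r≤rhs = subst (_≤ (q - r) + ((p - q) ⊔ 0ℚ)) (sym p-r≡[q-r]+[p-q])
                  (+-monoʳ-≤ (q - r) (p≤p⊔q (p - q) 0ℚ))
  0≤rhs : 0ℚ ≤ (q - r) + ((p - q) ⊔ 0ℚ)
  0≤rhs = +-mono-≤ (p≤q⇒0≤q-p r≤q) (p≤q⊔p (p - q) 0ℚ)

hover-energy-trade : ∀ eₛ eᵥ dₛ dᵥ T P → 0ℚ ≤ P → dₛ ≤ dᵥ → eₛ + (dᵥ - dₛ) * P ≤ eᵥ →
                     eₛ + ((T - dₛ) ⊔ 0ℚ) * P ≤ eᵥ + ((T - dᵥ) ⊔ 0ℚ) * P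
hover-energy-trade eₛ eᵥ dₛ dᵥ T P 0≤P dₛ≤dᵥ trade = begin
  eₛ + ((T - dₛ) ⊔ 0ℚ) * P                   ≤⟨ +-monoʳ-≤ eₛ (*-monoʳ-≤-nonNeg P hover≤) ⟩
  eₛ + ((dᵥ - dₛ) + ((T - dᵥ) ⊔ 0ℚ)) * P     ≡⟨ distrib eₛ (dᵥ - dₛ) ((T - dᵥ) ⊔ 0ℚ) P ⟩
  (eₛ + (dᵥ - dₛ) * P) + ((T - dᵥ) ⊔ 0ℚ) * P ≤⟨ +-monoˡ-≤ (((T - dᵥ) ⊔ 0ℚ) * P) trade ⟩
  eᵥ + ((T - dᵥ) ⊔ 0ℚ) * P                   ∎
  where
  open ≤-Reasoning
  instance _ = nonNegative 0≤P
  hover≤ : (T - dₛ) ⊔ 0ℚ ≤ (dᵥ - dₛ) + ((T - dᵥ) ⊔ 0ℚ)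
  hover≤ = [p-r]⊔0≤[q-r]+[p-q]⊔0 T dᵥ dₛ dₛ≤dᵥ
  distrib : ∀ e d h P → e + (d + h) * P ≡ (e + d * P) + h * P
  distrib = solve 4 (λ e d h P → e :+ (d :+ h) :* P := (e :+ d :* P) :+ h :* P) refl

module _ {c : ℕ} (I : Instance c) (F : Flight I) where
  open Instance I
  open Flight F

  duration-antimono : ∀ {v s} (v∈V : v ∈ V) (s∈V : s ∈ V) → v ≤ s →
                      duration I F s s∈V ≤ duration I F v v∈V
  duration-antimono {v} {s} v∈V s∈V v≤s =
    +-mono-≤ (+-monoˡ-≤ (τSD j) (*-monoˡ-≤-nonNeg (δD i j) 1/s≤1/v))
             (*-monoˡ-≤-nonNeg (δD j k) 1/s≤1/v)
    where
    instance
      _ = positive (All.lookup V>0 v∈V)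
      _ = positive (All.lookup V>0 s∈V)
      _ = pos⇒nonZero v
      _ = pos⇒nonZero s
      _ = nonNegative (δD≥0 i j)
      _ = nonNegative (δD≥0 j k)
    1/s≤1/v : 1/ s ≤ 1/ v
    1/s≤1/v = 1/-antimono-≤-pos v≤s

  energy-antimono : ∀ {v s} (v∈V : v ∈ V) (s∈V : s ∈ V) → v ≤ s →
                    e i j k s + (duration I F v v∈V - duration I F s s∈V) * PH0 ≤ e i j k v →
                    ∀ T → energy I F s s∈V T ≤ energy I F v v∈V T
  energy-antimono {v} {s} v∈V s∈V v≤s trade T =
    hover-energy-trade (e i j k s) (e i j k v) (duration I F s s∈V) (duration I F v v∈V)
                       T PH0 (<⇒≤ PH0>0) (duration-antimono v∈V s∈V v≤s) trade

proposition1 : {c : ℕ} (I : Instance c) (F : Flight I)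
    (v s : ℚ) (v∈V : v ∈ Instance.V I) (s∈V : s ∈ Instance.V I) →
    v < s →
    Instance.e I (Flight.i F) (Flight.j F) (Flight.k F) s
      + (duration I F v v∈V - duration I F s s∈V) * Instance.PH0 I
      ≤ Instance.e I (Flight.i F) (Flight.j F) (Flight.k F) v →
    Dominated I F v v∈V s s∈V
proposition1 I F v s v∈V s∈V v<s trade σ feasible =
  ≤-trans energy≤ feasible , ⊔-monoˡ-≤ T (duration-antimono I F v∈V s∈V v≤s) , energy≤
  where
  T : ℚ
  T = Scenario.T σ
  v≤s : v ≤ s
  v≤s = <⇒≤ v<s
  energy≤ : energy I F s s∈V T ≤ energy I F v v∈V T
  energy≤ = energy-antimono I F v∈V s∈V v≤s trade T
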